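{- Let $n\in\mathbb N$, $n\ge3$, and let $\mathcal H_n$ be the directed $n\times n$ grid with monitor placement $\chi_{\mathtt g}$. Then $\mu(\mathcal H_n\mid\chi_{\mathtt g})=2$, under either the $\mathrm{CSP}$ or the $\mathrm{CAP}^-$ routing mechanism.
   Context: $\mathcal H_n$ is the directed graph with vertex set $[n]^2$ and an edge from $(x_1,x_2)$ to $(y_1,y_2)$ iff for some $i\in\{1,2\}$, $y_i-x_i=1$ and the other coordinate agrees. The monitor placement $\chi_{\mathtt g}=(\mathfrak m,\mathfrak M)$ has input nodes $\mathfrak m=\{(x_1,x_2): x_1=1\text{ or }x_2=1\}$ and output nodes $\mathfrak M=\{(x_1,x_2): x_1=n\text{ or }x_2=n\}$. The set of measurement paths $\mathbb P(G\mid\chi)$ (directed paths) depends on the routing mechanism: under $\mathrm{CSP}$ it consists of all simple directed paths from a node of $\mathfrak m$ to a different node of $\mathfrak M$; under $\mathrm{CAP}^-$ it consists of all directed walks starting in $\mathfrak m$ and ending in $\mathfrak M$, except single-node paths consisting of one node in $\mathfrak m\cap\mathfrak M$. For a node $v$, $\mathbb P(v)$ is the set of measurement paths through $v$, $\mathbb P(U)=\bigcup_{u\in U}\mathbb P(u)$. $V$ is $k$-identifiable if for all $U,W\subseteq V$ with $U\neq W$ and $|U|,|W|\le k$, $\mathbb P(U)\neq\mathbb P(W)$. $\mu(G\mid\chi)$ is the largest $k\ge0$ such that $V$ is $k$-identifiable. -}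

module Defs where

open import Data.Nat using (ℕ; zero; suc; _≤_)
open import Data.Fin using (Fin; toℕ)
open import Data.Product using (Σ; _×_; _,_)
open import Data.Sum using (_⊎_)
open import Data.List using (List; []; _∷_; length)
open import Data.List.Membership.Propositional using (_∈_)
open import Data.List.Relation.Unary.Unique.Propositional using (Unique)
open import Relation.Binary.PropositionalEquality using (_≡_; _≢_)
open import Relation.Nullary using (¬_)
open import Function.Bundles using (_⇔_)

data Walk {V : Set} (E : V → V → Set) : V → V → List V → Set where
  stop : ∀ v → Walk E v v (v ∷ [])
  step : ∀ {u v w vs} → E u v → Walk E v w vs → Walk E u w (u ∷ vs)

data Routing : Set where
  CSP CAP⁻ : Routing

-- Measurement paths P(G | χ) for χ = (m , M), as vertex sequences.
MeasPath : {V : Set} → (E : V → V → Set) → (m M : V → Set) →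
           Routing → List V → Set
MeasPath E m M CSP p =
  Σ _ λ s → Σ _ λ t → Walk E s t p × Unique p × m s × M t × s ≢ t
MeasPath E m M CAP⁻ p =
  Σ _ λ s → Σ _ λ t → Walk E s t p × m s × M t ×
    ¬ (Σ _ λ v → p ≡ v ∷ [] × m v × M v)

PathsThrough : {V : Set} → (E : V → V → Set) → (m M : V → Set) →
               Routing → List V → List V → Set
PathsThrough {V} E m M r U p = MeasPath E m M r p × Σ V λ u → u ∈ U × u ∈ p

-- Subsets of V of size ≤ k are given as duplicate-free
-- lists; two subsets are distinct iff their memberships differ, and two
-- path sets are equal iff they have the same members.
Identifiable : {V : Set} → (E : V → V → Set) → (m M : V → Set) →
               Routing → ℕ → Set
Identifiable {V} E m M r k =
  (U W : List V) → Unique U → Unique W → length U ≤ k → length W ≤ k →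
  ¬ (∀ v → (v ∈ U) ⇔ (v ∈ W)) →
  ¬ (∀ p → PathsThrough E m M r U p ⇔ PathsThrough E m M r W p)

IsMu : {V : Set} → (E : V → V → Set) → (m M : V → Set) →
       Routing → ℕ → Set
IsMu E m M r k = Identifiable E m M r k × (∀ j → Identifiable E m M r j → j ≤ k)

-- The directed n×n grid H_n with placement χ_g.
-- [n] is represented by Fin n (coordinate i ∈ [n] ↦ i-1).

GridV : ℕ → Set
GridV n = Fin n × Fin n

GridE : (n : ℕ) → GridV n → GridV n → Set
GridE n (x₁ , x₂) (y₁ , y₂) =
  (toℕ y₁ ≡ suc (toℕ x₁) × x₂ ≡ y₂) ⊎ (x₁ ≡ y₁ × toℕ y₂ ≡ suc (toℕ x₂))

GridIn : (n : ℕ) → GridV n → Set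
GridIn n (x₁ , x₂) = toℕ x₁ ≡ 0 ⊎ toℕ x₂ ≡ 0

GridOut : (n : ℕ) → GridV n → Set
GridOut n (x₁ , x₂) = suc (toℕ x₁) ≡ n ⊎ suc (toℕ x₂) ≡ n

module Submission where

-- Write n = m + 1 and rank (x₁ , x₂) = x₁ + x₂.  Every edge raises the rank by
-- one, so walks are simple, and a walk from an input node to an output node of
-- larger rank ("rising" path) is a measurement path for both routings.
--
-- Let |U|, |W| ≤ 2 have the same path sets.
--  * Avoidance: for u ∉ W, either a rising path through u avoids W, or W covers
--    u, i.e. W consists of two distinct in-neighbours of u, two distinct
--    out-neighbours of u, or (u a corner) an in- and an out-neighbour of u.
--    This is shown with four in-walks and four out-walks along rows and columns.
--  * Hence every node of U ∖ W is covered by W, and vice versa.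
--  * Exchange: a node of U ∖ W whose lower-rank nodes of W all lie in U cannot
--    exist (case analysis on its cover, using |U|, |W| ≤ 2, that nodes of
--    different rank differ, that distinct nodes share at most one successor, and
--    that distinct corners share no in-neighbour).  Induction on rank: U = W.  The origin has no in-neighbour, so every measurement path through
-- it meets {(1,2), (2,1)}; this set and {(1,1), (1,2), (2,1)} are not separated.

open import Defs
open import Data.Nat using (ℕ; zero; suc; _≤_; _<_; _+_; z≤n; s≤s; _≤?_; _≟_)
open import Data.Nat.Properties
  using (≤-refl; ≤-trans; ≤-reflexive; <-≤-trans; <-irrefl; suc-injective;
         +-cancelʳ-≡; ≤∧≢⇒<; m<1+n⇒m≤n; ≰⇒>; 1+n≢0; 1+n≢n; +-suc; <⇒≤; ≤-<-trans)
open import Data.Fin using (Fin; toℕ; zero; suc; fromℕ; inject₁; fromℕ<)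
  renaming (_≟_ to _≟F_)
open import Data.Fin.Properties using (toℕ-inject₁; toℕ-fromℕ; toℕ-fromℕ<; toℕ-injective; toℕ<n)
open import Data.Product using (Σ; _×_; _,_; proj₁; proj₂)
open import Data.Product.Properties using (≡-dec)
open import Data.Sum using (_⊎_; inj₁; inj₂)
open import Data.List using (List; []; _∷_; length; map; _++_)
open import Data.List.Membership.Propositional using (_∈_; _∉_; find; lose)
open import Data.List.Membership.Propositional.Properties using (∈-map⁻; ∈-++⁻; ∈-++⁺ˡ)
open import Data.List.Relation.Unary.Any using (here; there; any?)
open import Data.List.Relation.Unary.All as All using ([]; _∷_)
open import Data.List.Relation.Unary.AllPairs using ([]; _∷_)
open import Data.List.Relation.Unary.Unique.Propositional using (Unique)
open import Data.Empty using (⊥; ⊥-elim)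
open import Relation.Nullary using (¬_; Dec; yes; no; _×-dec_; _⊎-dec_)
open import Relation.Binary.PropositionalEquality
  using (_≡_; _≢_; refl; sym; trans; cong; cong₂; ≢-sym)
open import Function.Bundles using (_⇔_; mk⇔; Equivalence)

walk-map : ∀ {V V′ : Set} {E : V → V → Set} {E′ : V′ → V′ → Set} (f : V → V′) →
           (∀ {x y} → E x y → E′ (f x) (f y)) →
           ∀ {s t p} → Walk E s t p → Walk E′ (f s) (f t) (map f p)
walk-map f f-edge (stop v) = stop (f v)
walk-map f f-edge (step e w) = step (f-edge e) (walk-map f f-edge w)

module _ {V : Set} {E : V → V → Set} where

  walk-++ : ∀ {s u t p q} → Walk E s u p → Walk E u t (u ∷ q) → Walk E s t (p ++ q)
  walk-++ (stop v) w = w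
  walk-++ (step e w₁) w = step e (walk-++ w₁ w)

  walk-first : ∀ {s t p} → Walk E s t p → s ∈ p
  walk-first (stop v) = here refl
  walk-first (step e w) = here refl

  walk-last : ∀ {s t p} → Walk E s t p → t ∈ p
  walk-last (stop v) = here refl
  walk-last (step e w) = there (walk-last w)

  walk-start-or-pred : ∀ {s t p v} → Walk E s t p → v ∈ p →
                       v ≡ s ⊎ Σ V λ w → w ∈ p × E w v
  walk-start-or-pred (stop _) (here refl) = inj₁ refl
  walk-start-or-pred (step e w) (here refl) = inj₁ refl
  walk-start-or-pred (step e w) (there v∈) with walk-start-or-pred w v∈
  ... | inj₁ refl = inj₂ (_ , here refl , e)
  ... | inj₂ (u , u∈ , e′) = inj₂ (u , there u∈ , e′)

  walk-nonempty : ∀ {s t} → ¬ Walk E s t []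
  walk-nonempty ()

  walk-single : ∀ {s t v} → Walk E s t (v ∷ []) → s ≡ t
  walk-single (stop v) = refl
  walk-single (step e ())

n≢2+n : ∀ {n : ℕ} → n ≢ suc (suc n)
n≢2+n ()

_⇾_ : ∀ {k} → Fin k → Fin k → Set
i ⇾ j = toℕ j ≡ suc (toℕ i)

⇾-≢ : ∀ {k} {i j : Fin k} → i ⇾ j → i ≢ j
⇾-≢ i⇾j refl = 1+n≢n (sym i⇾j)

suc-⇾ : ∀ {k} {i j : Fin k} → i ⇾ j → suc i ⇾ suc j
suc-⇾ = cong suc

inject₁-⇾ : ∀ {k} (i : Fin k) → inject₁ i ⇾ suc i
inject₁-⇾ i = cong suc (sym (toℕ-inject₁ i))

⇾-next : ∀ {k} (i : Fin (suc k)) → toℕ i ≢ k → Σ (Fin (suc k)) (i ⇾_)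
⇾-next {k} i i≢k = suc (fromℕ< i<k) , cong suc (toℕ-fromℕ< i<k)
  where
  i<k : toℕ i < k
  i<k = ≤∧≢⇒< (m<1+n⇒m≤n (toℕ<n i)) i≢k

chainTo : ∀ {k} → Fin k → List (Fin k)
chainTo zero = zero ∷ []
chainTo (suc i) = zero ∷ map suc (chainTo i)

chainTo-walk : ∀ {k} (i : Fin (suc k)) → Walk _⇾_ zero i (chainTo i)
chainTo-walk zero = stop zero
chainTo-walk {suc k} (suc i) = step refl (walk-map suc suc-⇾ (chainTo-walk i))

chainFrom : ∀ {k} → Fin (suc k) → List (Fin (suc k))
chainFrom {k} zero = chainTo (fromℕ k)
chainFrom {suc k} (suc i) = map suc (chainFrom i)

chainFrom-walk : ∀ {k} (i : Fin (suc k)) → Walk _⇾_ i (fromℕ k) (chainFrom i)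
chainFrom-walk {k} zero = chainTo-walk (fromℕ k)
chainFrom-walk {suc k} (suc i) = walk-map suc suc-⇾ (chainFrom-walk i)

pair-exhausts : ∀ {A : Set} {W : List A} {a b c} → length W ≤ 2 →
                a ∈ W → b ∈ W → a ≢ b → c ∈ W → c ≡ a ⊎ c ≡ b
pair-exhausts {W = _ ∷ []} _ (here refl) (here refl) a≢b _ = ⊥-elim (a≢b refl)
pair-exhausts {W = _ ∷ _ ∷ []} _ (here refl) (here refl) a≢b _ = ⊥-elim (a≢b refl)
pair-exhausts {W = _ ∷ _ ∷ []} _ (there (here refl)) (there (here refl)) a≢b _ = ⊥-elim (a≢b refl)
pair-exhausts {W = _ ∷ _ ∷ []} _ (here refl) (there (here refl)) _ (here refl) = inj₁ refl
pair-exhausts {W = _ ∷ _ ∷ []} _ (here refl) (there (here refl)) _ (there (here refl)) = inj₂ refl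
pair-exhausts {W = _ ∷ _ ∷ []} _ (there (here refl)) (here refl) _ (here refl) = inj₂ refl
pair-exhausts {W = _ ∷ _ ∷ []} _ (there (here refl)) (here refl) _ (there (here refl)) = inj₁ refl
pair-exhausts {W = _ ∷ _ ∷ _ ∷ _} (s≤s (s≤s ())) _ _ _ _

no-three-distinct : ∀ {A : Set} {W : List A} {a b c} → length W ≤ 2 →
                    a ∈ W → b ∈ W → c ∈ W → a ≢ b → a ≢ c → b ≢ c → ⊥
no-three-distinct |W|≤2 a∈ b∈ c∈ a≢b a≢c b≢c with pair-exhausts |W|≤2 a∈ b∈ a≢b c∈
... | inj₁ c≡a = a≢c (sym c≡a)
... | inj₂ c≡b = b≢c (sym c≡b)

-- The grid Hₙ with n = suc m; coordinates run over 0 … m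

module Grid (m : ℕ) where

  V : Set
  V = GridV (suc m)

  E : V → V → Set
  E = GridE (suc m)

  In Out : V → Set
  In = GridIn (suc m)
  Out = GridOut (suc m)

  variable
    u v w s t p q x : V
    ps W : List V
    i j ℓ : ℕ

  row-edge : ∀ y {x x′} → x ⇾ x′ → E (x , y) (x′ , y)
  row-edge y x⇾x′ = inj₁ (x⇾x′ , refl)

  col-edge : ∀ x {y y′} → y ⇾ y′ → E (x , y) (x , y′)
  col-edge x y⇾y′ = inj₂ (refl , y⇾y′)

  last-row-out : ∀ y → Out (fromℕ m , y)
  last-row-out y = inj₁ (cong suc (toℕ-fromℕ m))

  last-col-out : ∀ x → Out (x , fromℕ m)
  last-col-out x = inj₂ (cong suc (toℕ-fromℕ m))

  m≢0 : 2 ≤ m → m ≢ 0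
  m≢0 (s≤s _) ()

  coords-≡ : toℕ (proj₁ u) ≡ toℕ (proj₁ v) → toℕ (proj₂ u) ≡ toℕ (proj₂ v) → u ≡ v
  coords-≡ x≡ y≡ = cong₂ _,_ (toℕ-injective x≡) (toℕ-injective y≡)

  _≟V_ : (u v : V) → Dec (u ≡ v)
  _≟V_ = ≡-dec _≟F_ _≟F_

  open import Data.List.Membership.DecPropositional _≟V_ using (_∈?_)

  swap : V → V
  swap (x , y) = (y , x)

  swap-edge : E u v → E (swap u) (swap v)
  swap-edge (inj₁ (e , refl)) = inj₂ (refl , e)
  swap-edge (inj₂ (refl , e)) = inj₁ (e , refl)

  swap-in : In u → In (swap u)
  swap-in (inj₁ x≡0) = inj₂ x≡0
  swap-in (inj₂ y≡0) = inj₁ y≡0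

  swap-out : Out u → Out (swap u)
  swap-out (inj₁ x≡m) = inj₂ x≡m
  swap-out (inj₂ y≡m) = inj₁ y≡m

  rank : V → ℕ
  rank (x , y) = toℕ x + toℕ y

  rank-step : E u v → rank v ≡ suc (rank u)
  rank-step {x₁ , x₂} (inj₁ (e , refl)) = cong (_+ toℕ x₂) e
  rank-step {x₁ , x₂} (inj₂ (refl , e)) = trans (cong (toℕ x₁ +_) e) (+-suc (toℕ x₁) (toℕ x₂))

  edge-< : E u v → rank u < rank v
  edge-< e = ≤-reflexive (sym (rank-step e))

  record Level (ℓ i : ℕ) (u : V) : Set where
    constructor level
    field rank≡ : rank u ≡ i + ℓ

  base : Level (rank u) 0 u
  base = level refl

  up : E u v → Level ℓ i u → Level ℓ (suc i) v
  up e (level u-at-i) = level (trans (rank-step e) (cong suc u-at-i))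

  down : E u v → Level ℓ (suc i) v → Level ℓ i u
  down e (level v-at-1+i) = level (suc-injective (trans (sym (rank-step e)) v-at-1+i))

  level-≢ : Level ℓ i u → Level ℓ j v → i ≢ j → u ≢ v
  level-≢ (level u-at-i) (level v-at-j) i≢j refl =
    i≢j (+-cancelʳ-≡ _ _ _ (trans (sym u-at-i) v-at-j))

  path₂-≢ : E u v → E v w → u ≢ w
  path₂-≢ e₁ e₂ = level-≢ base (up e₂ (up e₁ base)) (λ ())

  edge-≢ : E u v → u ≢ v
  edge-≢ e = level-≢ base (up e base) (λ ())

  walk-rank-≤ : Walk E s t ps → v ∈ ps → rank s ≤ rank v
  walk-rank-≤ (stop _) (here refl) = ≤-refl
  walk-rank-≤ (step e w) (here refl) = ≤-refl
  walk-rank-≤ (step e w) (there v∈) = ≤-trans (<⇒≤ (edge-< e)) (walk-rank-≤ w v∈)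

  walk-rank-< : Walk E s t ps → s ≢ t → rank s < rank t
  walk-rank-< (stop _) s≢t = ⊥-elim (s≢t refl)
  walk-rank-< (step e w) s≢t = <-≤-trans (edge-< e) (walk-rank-≤ w (walk-last w))

  walk-unique : Walk E s t ps → Unique ps
  walk-unique (stop v) = [] ∷ []
  walk-unique (step e w) = All.tabulate head-fresh ∷ walk-unique w
    where
    head-fresh : x ∈ _ → _ ≢ x
    head-fresh x∈ s≡x = <-irrefl (cong rank s≡x) (<-≤-trans (edge-< e) (walk-rank-≤ w x∈))

  Rising : List V → Set
  Rising ps = Σ V λ s → Σ V λ t → Walk E s t ps × In s × Out t × rank s < rank t

  rising-measured : ∀ r → Rising ps → MeasPath E In Out r ps
  rising-measured CSP (s , t , w , in-s , out-t , s<t) =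
    s , t , w , walk-unique w , in-s , out-t , λ s≡t → <-irrefl (cong rank s≡t) s<t
  rising-measured CAP⁻ (s , t , w , in-s , out-t , s<t) =
    s , t , w , in-s , out-t , λ { (_ , refl , _) → <-irrefl (cong rank (walk-single w)) s<t }

  measured-nontrivial : ∀ r → MeasPath E In Out r ps →
                        Σ V λ s → Σ V λ t → Walk E s t ps × (∀ v → ps ≢ v ∷ [])
  measured-nontrivial CSP (s , t , w , _ , _ , _ , s≢t) =
    s , t , w , λ { _ refl → s≢t (walk-single w) }
  measured-nontrivial CAP⁻ (s , t , w@(stop _) , in-s , out-t , not-single) =
    ⊥-elim (not-single (s , refl , in-s , out-t))
  measured-nontrivial CAP⁻ (s , t , w@(step _ rest) , _ , _ , _) =
    s , t , w , λ { _ refl → walk-nonempty rest }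

  Meets Avoids : List V → List V → Set
  Meets W ps = Σ V λ w → w ∈ W × w ∈ ps
  Avoids W ps = ¬ Meets W ps

  meets? : ∀ W ps → Avoids W ps ⊎ Meets W ps
  meets? W ps with any? (_∈? ps) W
  ... | yes hit = inj₂ (find hit)
  ... | no miss = inj₁ λ (w , w∈W , w∈ps) → miss (lose w∈W w∈ps)

  avoids : All.All (_∉ W) ps → Avoids W ps
  avoids outside (w , w∈W , w∈ps) = All.lookup outside w∈ps w∈W

  -- In each case every rising path through u meets {p , q}.
  data Shape (u : V) : V → V → Set where
    preds  : E p u → E q u → Shape u p q
    succs  : E u p → E u q → Shape u p q
    corner : In u → Out u → E p u → E u q → Shape u p q

  data Cover (W : List V) (u : V) : Set where
    cover : p ∈ W → q ∈ W → p ≢ q → Shape u p q → Cover W u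

  common-successor-unique : p ≢ q → E p u → E q u → E p v → E q v → u ≡ v
  common-successor-unique {p₁ , p₂} _ (inj₁ (a , refl)) _ (inj₁ (b , refl)) _ =
    cong (_, p₂) (toℕ-injective (trans a (sym b)))
  common-successor-unique {p₁ , p₂} _ (inj₂ (refl , a)) _ (inj₂ (refl , b)) _ =
    cong (p₁ ,_) (toℕ-injective (trans a (sym b)))
  common-successor-unique p≢q (inj₁ (a , refl)) (inj₁ (c , refl)) (inj₂ (refl , _)) _ =
    ⊥-elim (p≢q (cong (_, _) (toℕ-injective (suc-injective (trans (sym a) c)))))
  common-successor-unique p≢q (inj₂ (refl , a)) (inj₂ (refl , c)) (inj₁ (_ , refl)) _ =
    ⊥-elim (p≢q (cong (_ ,_) (toℕ-injective (suc-injective (trans (sym a) c)))))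
  common-successor-unique _ (inj₁ (a , refl)) (inj₂ (refl , _)) (inj₂ (refl , _)) (inj₁ (d , refl)) =
    ⊥-elim (n≢2+n (trans d (cong suc a)))
  common-successor-unique _ (inj₂ (refl , a)) (inj₁ (_ , refl)) (inj₁ (_ , refl)) (inj₂ (refl , d)) =
    ⊥-elim (n≢2+n (trans d (cong suc a)))
  common-successor-unique _ (inj₁ (a , refl)) (inj₂ (refl , _)) (inj₂ (refl , _)) (inj₂ (refl , _)) =
    ⊥-elim (1+n≢n (sym a))
  common-successor-unique _ (inj₂ (refl , a)) (inj₁ (_ , refl)) (inj₁ (_ , refl)) (inj₁ (_ , refl)) =
    ⊥-elim (1+n≢n (sym a))

  corner-position : m ≢ 0 → In u → Out u →
                    (toℕ (proj₁ u) ≡ 0 × toℕ (proj₂ u) ≡ m) ⊎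
                    (toℕ (proj₁ u) ≡ m × toℕ (proj₂ u) ≡ 0)
  corner-position m≢0 (inj₁ x≡0) (inj₁ x+1≡n) =
    ⊥-elim (m≢0 (trans (sym (suc-injective x+1≡n)) x≡0))
  corner-position _ (inj₁ x≡0) (inj₂ y+1≡n) = inj₁ (x≡0 , suc-injective y+1≡n)
  corner-position _ (inj₂ y≡0) (inj₁ x+1≡n) = inj₂ (suc-injective x+1≡n , y≡0)
  corner-position m≢0 (inj₂ y≡0) (inj₂ y+1≡n) =
    ⊥-elim (m≢0 (trans (sym (suc-injective y+1≡n)) y≡0))

  -- The corners (0 , m) and (m , 0) have no common in-neighbour when n ≥ 3:
  -- it would have to be (0 , m - 1) = (m - 1 , 0).
  opposite-corners-apart : 2 ≤ m → toℕ (proj₁ p) ≡ 0 → toℕ (proj₂ p) ≡ m →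
                           toℕ (proj₁ q) ≡ m → toℕ (proj₂ q) ≡ 0 → E u p → E u q → ⊥
  opposite-corners-apart _ p₁≡0 _ _ _ (inj₁ (e , _)) _ = 1+n≢0 (trans (sym e) p₁≡0)
  opposite-corners-apart _ _ _ _ q₂≡0 (inj₂ _) (inj₂ (_ , e)) = 1+n≢0 (trans (sym e) q₂≡0)
  opposite-corners-apart (s≤s (s≤s _)) _ p₂≡m _ q₂≡0 (inj₂ (refl , e)) (inj₁ (_ , refl))
    with trans (sym p₂≡m) (trans e (cong suc q₂≡0))
  ... | ()

  corners-apart : 2 ≤ m → p ≢ q → In p → Out p → In q → Out q → E u p → E u q → ⊥
  corners-apart 2≤m p≢q in-p out-p in-q out-q e-p e-q
    with corner-position (m≢0 2≤m) in-p out-p | corner-position (m≢0 2≤m) in-q out-q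
  ... | inj₁ (p₁ , p₂) | inj₁ (q₁ , q₂) =
    p≢q (coords-≡ (trans p₁ (sym q₁)) (trans p₂ (sym q₂)))
  ... | inj₂ (p₁ , p₂) | inj₂ (q₁ , q₂) =
    p≢q (coords-≡ (trans p₁ (sym q₁)) (trans p₂ (sym q₂)))
  ... | inj₁ (p₁ , p₂) | inj₂ (q₁ , q₂) = opposite-corners-apart 2≤m p₁ p₂ q₁ q₂ e-p e-q
  ... | inj₂ (p₁ , p₂) | inj₁ (q₁ , q₂) = opposite-corners-apart 2≤m q₁ q₂ p₁ p₂ e-q e-p

  CornerNeighbours : V → Set
  CornerNeighbours u = Σ V λ p → Σ V λ q → E p u × E u q × In p × Out q

  corner₀-neighbours : m ≢ 0 → ∀ y → toℕ y ≡ m → CornerNeighbours (zero , y)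
  corner₀-neighbours m≢0 zero 0≡m = ⊥-elim (m≢0 (sym 0≡m))
  corner₀-neighbours m≢0 (suc y) y+1≡m with ⇾-next zero (≢-sym m≢0)
  ... | one , 0⇾1 =
    (zero , inject₁ y) , (one , suc y) ,
    col-edge zero (inject₁-⇾ y) , row-edge (suc y) 0⇾1 , inj₁ refl , inj₂ (cong suc y+1≡m)

  corner-neighbours : m ≢ 0 → In u → Out u → CornerNeighbours u
  corner-neighbours {zero , y} m≢0 _ (inj₁ 1≡n) = ⊥-elim (m≢0 (sym (suc-injective 1≡n)))
  corner-neighbours {zero , y} m≢0 _ (inj₂ y+1≡n) = corner₀-neighbours m≢0 y (suc-injective y+1≡n)
  corner-neighbours {suc x , zero} m≢0 _ (inj₁ x+1≡n)
    with corner₀-neighbours m≢0 (suc x) (suc-injective x+1≡n)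
  ... | p , q , e-p , e-q , in-p , out-q =
    swap p , swap q , swap-edge e-p , swap-edge e-q , swap-in in-p , swap-out out-q
  corner-neighbours {suc x , zero} m≢0 _ (inj₂ 1≡n) = ⊥-elim (m≢0 (sym (suc-injective 1≡n)))
  corner-neighbours {suc x , suc y} _ (inj₁ ()) _
  corner-neighbours {suc x , suc y} _ (inj₂ ()) _

  FromInput ToOutput : List V → V → Set
  FromInput W u = Σ V λ s → Σ (List V) λ ps → Walk E s u ps × In s × Avoids W ps
  ToOutput W u = Σ V λ t → Σ (List V) λ ps → Walk E u t ps × Out t × Avoids W ps

  -- Four in-walks into target = (a , b) with a , b ≥ 1: along row b, along column a,
  -- up column a - 1 and then right, along row b - 1 and then up.  If W (at most
  -- two nodes, target ∉ W) meets all four, W consists of the in-neighbours of target.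
  module InWalks (W : List V) (a′ b′ : Fin m) (|W|≤2 : length W ≤ 2)
                 (target∉W : (suc a′ , suc b′) ∉ W) where
    a b : Fin (suc m)
    a = suc a′
    b = suc b′

    target : V
    target = (a , b)

    row col col-right row-up : List V
    row = map (_, b) (chainTo a)
    col = map (a ,_) (chainTo b)
    col-right = map (inject₁ a′ ,_) (chainTo b) ++ (target ∷ [])
    row-up = map (_, inject₁ b′) (chainTo a) ++ (target ∷ [])

    row-walk : Walk E (zero , b) target row
    row-walk = walk-map (_, b) (row-edge b) (chainTo-walk a)

    col-walk : Walk E (a , zero) target col
    col-walk = walk-map (a ,_) (col-edge a) (chainTo-walk b)

    col-right-walk : Walk E (inject₁ a′ , zero) target col-right
    col-right-walk = walk-++ (walk-map (inject₁ a′ ,_) (col-edge (inject₁ a′)) (chainTo-walk b))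
                             (step (row-edge b (inject₁-⇾ a′)) (stop target))

    row-up-walk : Walk E (zero , inject₁ b′) target row-up
    row-up-walk = walk-++ (walk-map (_, inject₁ b′) (row-edge (inject₁ b′)) (chainTo-walk a))
                          (step (col-edge a (inject₁-⇾ b′)) (stop target))

    -- W meets row in some (x , b) and col in some (a , y); these differ as target ∉ W.
    -- The member of W on col-right is in column a - 1, so it is (x , b), whence
    -- x = a - 1; symmetrically row-up forces y = b - 1.
    blocked : Meets W row → Meets W col → Meets W col-right → Meets W row-up → Cover W target
    blocked (w₁ , w₁∈W , w₁∈row) (w₂ , w₂∈W , w₂∈col)
            (w₃ , w₃∈W , w₃∈cr) (w₄ , w₄∈W , w₄∈ru)
      with ∈-map⁻ (_, b) w₁∈row | ∈-map⁻ (a ,_) w₂∈col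
    ... | x , _ , refl | y , _ , refl = cover w₁∈W w₂∈W w₁≢w₂ (preds x⇾a y⇾b)
      where
      w₁≢w₂ : (x , b) ≢ (a , y)
      w₁≢w₂ refl = target∉W w₁∈W

      x⇾a : E (x , b) target
      x⇾a with ∈-++⁻ (map (inject₁ a′ ,_) (chainTo b)) w₃∈cr
      ... | inj₂ (here refl) = ⊥-elim (target∉W w₃∈W)
      ... | inj₁ w₃∈col′ with ∈-map⁻ (inject₁ a′ ,_) w₃∈col′
      ... | _ , _ , refl with pair-exhausts |W|≤2 w₁∈W w₂∈W w₁≢w₂ w₃∈W
      ... | inj₁ refl = row-edge b (inject₁-⇾ a′)
      ... | inj₂ w₃≡w₂ = ⊥-elim (⇾-≢ (inject₁-⇾ a′) (cong proj₁ w₃≡w₂))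

      y⇾b : E (a , y) target
      y⇾b with ∈-++⁻ (map (_, inject₁ b′) (chainTo a)) w₄∈ru
      ... | inj₂ (here refl) = ⊥-elim (target∉W w₄∈W)
      ... | inj₁ w₄∈row′ with ∈-map⁻ (_, inject₁ b′) w₄∈row′
      ... | _ , _ , refl with pair-exhausts |W|≤2 w₁∈W w₂∈W w₁≢w₂ w₄∈W
      ... | inj₂ refl = col-edge a (inject₁-⇾ b′)
      ... | inj₁ w₄≡w₁ = ⊥-elim (⇾-≢ (inject₁-⇾ b′) (cong proj₂ w₄≡w₁))

    from-input-or-cover : FromInput W target ⊎ Cover W target
    from-input-or-cover with meets? W row | meets? W col | meets? W col-right | meets? W row-up
    ... | inj₁ avoid | _ | _ | _ = inj₁ (_ , _ , row-walk , inj₁ refl , avoid)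
    ... | _ | inj₁ avoid | _ | _ = inj₁ (_ , _ , col-walk , inj₂ refl , avoid)
    ... | _ | _ | inj₁ avoid | _ = inj₁ (_ , _ , col-right-walk , inj₂ refl , avoid)
    ... | _ | _ | _ | inj₁ avoid = inj₁ (_ , _ , row-up-walk , inj₁ refl , avoid)
    ... | inj₂ m₁ | inj₂ m₂ | inj₂ m₃ | inj₂ m₄ = inj₂ (blocked m₁ m₂ m₃ m₄)

  from-input-or-cover : length W ≤ 2 → u ∉ W → FromInput W u ⊎ Cover W u
  from-input-or-cover {u = zero , _} _ u∉W = inj₁ (_ , _ , stop _ , inj₁ refl , avoids (u∉W ∷ []))
  from-input-or-cover {u = suc _ , zero} _ u∉W = inj₁ (_ , _ , stop _ , inj₂ refl , avoids (u∉W ∷ []))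
  from-input-or-cover {W = W} {u = suc a′ , suc b′} |W|≤2 u∉W =
    InWalks.from-input-or-cover W a′ b′ |W|≤2 u∉W

  -- Four out-walks from source = (a , b) with a , b < m: along row b, along column a,
  -- right and then up column a + 1, up and then along row b + 1.  If W (at most
  -- two nodes, source ∉ W) meets all four, W consists of the out-neighbours of source.
  module OutWalks (W : List V) {a b a⁺ b⁺ : Fin (suc m)} (a⇾a⁺ : a ⇾ a⁺) (b⇾b⁺ : b ⇾ b⁺)
                  (|W|≤2 : length W ≤ 2) (source∉W : (a , b) ∉ W) where
    source : V
    source = (a , b)

    row col right-col up-row : List V
    row = map (_, b) (chainFrom a)
    col = map (a ,_) (chainFrom b)
    right-col = source ∷ map (a⁺ ,_) (chainFrom b)
    up-row = source ∷ map (_, b⁺) (chainFrom a)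

    row-walk : Walk E source (fromℕ m , b) row
    row-walk = walk-map (_, b) (row-edge b) (chainFrom-walk a)

    col-walk : Walk E source (a , fromℕ m) col
    col-walk = walk-map (a ,_) (col-edge a) (chainFrom-walk b)

    right-col-walk : Walk E source (a⁺ , fromℕ m) right-col
    right-col-walk = step (row-edge b a⇾a⁺) (walk-map (a⁺ ,_) (col-edge a⁺) (chainFrom-walk b))

    up-row-walk : Walk E source (fromℕ m , b⁺) up-row
    up-row-walk = step (col-edge a b⇾b⁺) (walk-map (_, b⁺) (row-edge b⁺) (chainFrom-walk a))

    -- As for in-walks: the members (x , b) and (a , y) of W on row and col are
    -- forced by right-col and up-row to be (a + 1 , b) and (a , b + 1).
    blocked : Meets W row → Meets W col → Meets W right-col → Meets W up-row → Cover W source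
    blocked (w₁ , w₁∈W , w₁∈row) (w₂ , w₂∈W , w₂∈col)
            (w₃ , w₃∈W , w₃∈rc) (w₄ , w₄∈W , w₄∈ur)
      with ∈-map⁻ (_, b) w₁∈row | ∈-map⁻ (a ,_) w₂∈col
    ... | x , _ , refl | y , _ , refl = cover w₁∈W w₂∈W w₁≢w₂ (succs a⇾x b⇾y)
      where
      w₁≢w₂ : (x , b) ≢ (a , y)
      w₁≢w₂ refl = source∉W w₁∈W

      a⇾x : E source (x , b)
      a⇾x with ∈-++⁻ (source ∷ []) w₃∈rc
      ... | inj₁ (here refl) = ⊥-elim (source∉W w₃∈W)
      ... | inj₂ w₃∈col′ with ∈-map⁻ (a⁺ ,_) w₃∈col′
      ... | _ , _ , refl with pair-exhausts |W|≤2 w₁∈W w₂∈W w₁≢w₂ w₃∈W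
      ... | inj₁ refl = row-edge b a⇾a⁺
      ... | inj₂ w₃≡w₂ = ⊥-elim (⇾-≢ a⇾a⁺ (sym (cong proj₁ w₃≡w₂)))

      b⇾y : E source (a , y)
      b⇾y with ∈-++⁻ (source ∷ []) w₄∈ur
      ... | inj₁ (here refl) = ⊥-elim (source∉W w₄∈W)
      ... | inj₂ w₄∈row′ with ∈-map⁻ (_, b⁺) w₄∈row′
      ... | _ , _ , refl with pair-exhausts |W|≤2 w₁∈W w₂∈W w₁≢w₂ w₄∈W
      ... | inj₂ refl = col-edge a b⇾b⁺
      ... | inj₁ w₄≡w₁ = ⊥-elim (⇾-≢ b⇾b⁺ (sym (cong proj₂ w₄≡w₁)))

    to-output-or-cover : ToOutput W source ⊎ Cover W source
    to-output-or-cover with meets? W row | meets? W col | meets? W right-col | meets? W up-row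
    ... | inj₁ avoid | _ | _ | _ = inj₁ (_ , _ , row-walk , last-row-out b , avoid)
    ... | _ | inj₁ avoid | _ | _ = inj₁ (_ , _ , col-walk , last-col-out a , avoid)
    ... | _ | _ | inj₁ avoid | _ = inj₁ (_ , _ , right-col-walk , last-col-out a⁺ , avoid)
    ... | _ | _ | _ | inj₁ avoid = inj₁ (_ , _ , up-row-walk , last-row-out b⁺ , avoid)
    ... | inj₂ m₁ | inj₂ m₂ | inj₂ m₃ | inj₂ m₄ = inj₂ (blocked m₁ m₂ m₃ m₄)

  to-output-or-cover : length W ≤ 2 → u ∉ W → ToOutput W u ⊎ Cover W u
  to-output-or-cover {W = W} {u = a , b} |W|≤2 u∉W with toℕ a ≟ m | toℕ b ≟ m
  ... | yes a≡m | _ = inj₁ (_ , _ , stop _ , inj₁ (cong suc a≡m) , avoids (u∉W ∷ []))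
  ... | no _ | yes b≡m = inj₁ (_ , _ , stop _ , inj₂ (cong suc b≡m) , avoids (u∉W ∷ []))
  ... | no a≢m | no b≢m with ⇾-next a a≢m | ⇾-next b b≢m
  ... | _ , a⇾a⁺ | _ , b⇾b⁺ = OutWalks.to-output-or-cover W a⇾a⁺ b⇾b⁺ |W|≤2 u∉W

  PathAvoiding : List V → V → Set
  PathAvoiding W u = Σ (List V) λ ps → Rising ps × u ∈ ps × Avoids W ps

  join-avoiding : ¬ (In u × Out u) → FromInput W u → ToOutput W u → PathAvoiding W u
  join-avoiding {u = u} not-corner (s , ps , in-walk , in-s , avoid-ps) (_ , _ , stop _ , out-u , _) =
    ps , (s , u , in-walk , in-s , out-u , walk-rank-< in-walk s≢u) , walk-last in-walk , avoid-ps
    where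
    s≢u : s ≢ u
    s≢u refl = not-corner (in-s , out-u)
  join-avoiding {u = u} {W = W} _ (s , ps , in-walk , in-s , avoid-ps)
                          (t , _ ∷ qs , out-walk@(step e rest) , out-t , avoid-qs) =
    ps ++ qs , (s , t , walk-++ in-walk out-walk , in-s , out-t , s<t) ,
    ∈-++⁺ˡ (walk-last in-walk) , avoid
    where
    s<t : rank s < rank t
    s<t = ≤-<-trans (walk-rank-≤ in-walk (walk-last in-walk))
                    (<-≤-trans (edge-< e) (walk-rank-≤ rest (walk-last rest)))
    avoid : Avoids W (ps ++ qs)
    avoid (w , w∈W , w∈) with ∈-++⁻ ps w∈
    ... | inj₁ w∈ps = avoid-ps (w , w∈W , w∈ps)
    ... | inj₂ w∈qs = avoid-qs (w , w∈W , there w∈qs)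

  corner-path-or-cover : m ≢ 0 → In u → Out u → u ∉ W → PathAvoiding W u ⊎ Cover W u
  corner-path-or-cover {u = u} {W = W} m≢0 in-u out-u u∉W with corner-neighbours m≢0 in-u out-u
  ... | p , q , e-p , e-q , in-p , out-q with p ∈? W | q ∈? W
  ... | no p∉W | _ = inj₁ (p ∷ u ∷ [] , (p , u , step e-p (stop u) , in-p , out-u , edge-< e-p) ,
                           there (here refl) , avoids (p∉W ∷ u∉W ∷ []))
  ... | yes _ | no q∉W = inj₁ (u ∷ q ∷ [] , (u , q , step e-q (stop q) , in-u , out-q , edge-< e-q) ,
                               here refl , avoids (u∉W ∷ q∉W ∷ []))
  ... | yes p∈W | yes q∈W = inj₂ (cover p∈W q∈W (path₂-≢ e-p e-q) (corner in-u out-u e-p e-q))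

  corner? : ∀ u → Dec (In u × Out u)
  corner? (x , y) = ((toℕ x ≟ 0) ⊎-dec (toℕ y ≟ 0))
             ×-dec ((suc (toℕ x) ≟ suc m) ⊎-dec (suc (toℕ y) ≟ suc m))

  path-or-cover : 2 ≤ m → length W ≤ 2 → u ∉ W → PathAvoiding W u ⊎ Cover W u
  path-or-cover {u = u} 2≤m |W|≤2 u∉W with corner? u
  ... | yes (in-u , out-u) = corner-path-or-cover (m≢0 2≤m) in-u out-u u∉W
  ... | no not-corner with from-input-or-cover |W|≤2 u∉W | to-output-or-cover |W|≤2 u∉W
  ...   | inj₂ covered | _ = inj₂ covered
  ...   | inj₁ _ | inj₂ covered = inj₂ covered
  ...   | inj₁ from-input | inj₁ to-output = inj₁ (join-avoiding not-corner from-input to-output)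

  module Exchange (2≤m : 2 ≤ m) (A B : List V) (|A|≤2 : length A ≤ 2) (|B|≤2 : length B ≤ 2)
                  (coverA : ∀ {y} → y ∈ A → y ∉ B → Cover B y)
                  (coverB : ∀ {y} → y ∈ B → y ∉ A → Cover A y) where

    -- Let B = {p , q} with p, q out-neighbours of x.  A node x′ ≢ x of A with x′ → p
    -- is impossible: x′ ∉ B, so B covers x′; B lies one level above x′, so the
    -- cover is by out-neighbours, and distinct x, x′ cannot share p and q.
    sibling-outside : ∀ {x′} → p ∈ B → q ∈ B → p ≢ q → E x p → E x q →
                      x′ ∈ A → x′ ≢ x → E x′ p → ⊥
    sibling-outside {p} {q} {x} {x′} p∈B q∈B p≢q x→p x→q x′∈A x′≢x x′→p =
      uncovered (coverA x′∈A x′∉B)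
      where
      x′-at-0 : Level (rank x) 0 x′
      x′-at-0 = down x′→p (up x→p base)

      x′∉B : x′ ∉ B
      x′∉B x′∈B = no-three-distinct |B|≤2 p∈B q∈B x′∈B p≢q
        (level-≢ (up x→p base) x′-at-0 (λ ())) (level-≢ (up x→q base) x′-at-0 (λ ()))

      -- an in-neighbour s of x′ is two levels below p and q
      no-pred-in-B : s ∈ B → E s x′ → ⊥
      no-pred-in-B {s} s∈B s→x′ = no-three-distinct |B|≤2 p∈B q∈B s∈B p≢q
        (level-≢ p-at-2 base (λ ())) (level-≢ (up x→q (down x→p p-at-2)) base (λ ()))
        where
        p-at-2 : Level (rank s) 2 p
        p-at-2 = up x′→p (up s→x′ base)

      uncovered : Cover B x′ → ⊥
      uncovered (cover s∈B _ _ (preds s→x′ _)) = no-pred-in-B s∈B s→x′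
      uncovered (cover s∈B _ _ (corner _ _ s→x′ _)) = no-pred-in-B s∈B s→x′
      uncovered (cover s₁∈B s₂∈B s₁≢s₂ (succs x′→s₁ x′→s₂)) =
        p≢q (common-successor-unique (≢-sym x′≢x) x→p x′→p x→q x′→q)
        where
        x′→q : E x′ q
        x′→q with pair-exhausts |B|≤2 s₁∈B s₂∈B s₁≢s₂ q∈B
        ... | inj₁ refl = x′→s₁
        ... | inj₂ refl = x′→s₂

    two-succs-outside : x ∈ A → p ∈ B → q ∈ B → p ≢ q → E x p → E x q → p ∉ A → ⊥
    two-succs-outside {x} {p} {q} x∈A p∈B q∈B p≢q x→p x→q p∉A = uncovered (coverB p∈B p∉A)
      where
      p-at-1 : Level (rank x) 1 p
      p-at-1 = up x→p base
      q-at-1 : Level (rank x) 1 q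
      q-at-1 = up x→q base

      uncovered : Cover A p → ⊥
      -- one of the two in-neighbours of p in A differs from x
      uncovered (cover {r₁} {r₂} r₁∈A r₂∈A r₁≢r₂ (preds r₁→p r₂→p)) with r₁ ≟V x
      ... | yes refl = sibling-outside p∈B q∈B p≢q x→p x→q r₂∈A (≢-sym r₁≢r₂) r₂→p
      ... | no r₁≢x = sibling-outside p∈B q∈B p≢q x→p x→q r₁∈A r₁≢x r₁→p
      -- the out-neighbours of p are on level 2: with x, three members of A
      uncovered (cover r₁∈A r₂∈A r₁≢r₂ (succs p→r₁ p→r₂)) =
        no-three-distinct |A|≤2 r₁∈A r₂∈A x∈A r₁≢r₂
          (level-≢ (up p→r₁ p-at-1) base (λ ())) (level-≢ (up p→r₂ p-at-1) base (λ ()))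
      -- p is a corner with an out-neighbour r ∈ A on level 2.  Then q ∉ A, and A
      -- cannot cover q: its in-neighbours are on level 0 and its out-neighbours on
      -- level 2 (each pair excluded by a third member of A), and q is no corner.
      uncovered (cover {q = r} _ r∈A _ (corner in-p out-p _ p→r)) = q-uncovered (coverB q∈B q∉A)
        where
        r-at-2 : Level (rank x) 2 r
        r-at-2 = up p→r p-at-1

        q∉A : q ∉ A
        q∉A q∈A = no-three-distinct |A|≤2 x∈A r∈A q∈A
          (level-≢ base r-at-2 (λ ())) (level-≢ base q-at-1 (λ ())) (level-≢ r-at-2 q-at-1 (λ ()))

        q-uncovered : Cover A q → ⊥
        q-uncovered (cover t₁∈A t₂∈A t₁≢t₂ (preds t₁→q t₂→q)) =
          no-three-distinct |A|≤2 t₁∈A t₂∈A r∈A t₁≢t₂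
            (level-≢ (down t₁→q q-at-1) r-at-2 (λ ())) (level-≢ (down t₂→q q-at-1) r-at-2 (λ ()))
        q-uncovered (cover t₁∈A t₂∈A t₁≢t₂ (succs q→t₁ q→t₂)) =
          no-three-distinct |A|≤2 t₁∈A t₂∈A x∈A t₁≢t₂
            (level-≢ (up q→t₁ q-at-1) base (λ ())) (level-≢ (up q→t₂ q-at-1) base (λ ()))
        q-uncovered (cover _ _ _ (corner in-q out-q _ _)) =
          corners-apart 2≤m p≢q in-p out-p in-q out-q x→p x→q

    -- A path p → x inside A and an out-neighbour q ∈ B of x are impossible: q ∉ A,
    -- yet A = {p , x} holds only one in-neighbour and no out-neighbour of q.
    path-outside : x ∈ A → p ∈ A → q ∈ B → E p x → E x q → ⊥
    path-outside {x} {p} {q} x∈A p∈A q∈B p→x x→q = uncovered (coverB q∈B q∉A)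
      where
      x-at-1 : Level (rank p) 1 x
      x-at-1 = up p→x base
      q-at-2 : Level (rank p) 2 q
      q-at-2 = up x→q x-at-1

      q∉A : q ∉ A
      q∉A q∈A = no-three-distinct |A|≤2 p∈A x∈A q∈A
        (level-≢ base x-at-1 (λ ())) (level-≢ base q-at-2 (λ ())) (level-≢ x-at-1 q-at-2 (λ ()))

      no-succ-in-A : t ∈ A → E q t → ⊥
      no-succ-in-A {t} t∈A q→t = no-three-distinct |A|≤2 p∈A x∈A t∈A
        (level-≢ base x-at-1 (λ ())) (level-≢ base t-at-3 (λ ())) (level-≢ x-at-1 t-at-3 (λ ()))
        where
        t-at-3 : Level (rank p) 3 t
        t-at-3 = up q→t q-at-2

      uncovered : Cover A q → ⊥
      uncovered (cover t₁∈A t₂∈A t₁≢t₂ (preds t₁→q t₂→q)) =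
        no-three-distinct |A|≤2 t₁∈A t₂∈A p∈A t₁≢t₂
          (level-≢ (down t₁→q q-at-2) base (λ ())) (level-≢ (down t₂→q q-at-2) base (λ ()))
      uncovered (cover t∈A _ _ (succs q→t _)) = no-succ-in-A t∈A q→t
      uncovered (cover _ t∈A _ (corner _ _ _ q→t)) = no-succ-in-A t∈A q→t

    no-least-difference : x ∈ A → x ∉ B → (∀ {y} → rank y < rank x → y ∈ B → y ∈ A) → ⊥
    no-least-difference {x} x∈A x∉B lower = uncovered (coverA x∈A x∉B)
      where
      uncovered : Cover B x → ⊥
      -- both in-neighbours lie in A as well: with x, three members of A
      uncovered (cover p∈B q∈B p≢q (preds p→x q→x)) =
        no-three-distinct |A|≤2 (lower (edge-< p→x) p∈B) (lower (edge-< q→x) q∈B) x∈A p≢q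
          (edge-≢ p→x) (edge-≢ q→x)
      -- at most one of the out-neighbours can lie in A besides x
      uncovered (cover {p} {q} p∈B q∈B p≢q (succs x→p x→q)) with p ∈? A | q ∈? A
      ... | no p∉A | _ = two-succs-outside x∈A p∈B q∈B p≢q x→p x→q p∉A
      ... | yes _ | no q∉A = two-succs-outside x∈A q∈B p∈B (≢-sym p≢q) x→q x→p q∉A
      ... | yes p∈A | yes q∈A =
        no-three-distinct |A|≤2 p∈A q∈A x∈A p≢q (≢-sym (edge-≢ x→p)) (≢-sym (edge-≢ x→q))
      -- the in-neighbour lies in A as well
      uncovered (cover p∈B q∈B _ (corner _ _ p→x x→q)) =
        path-outside x∈A (lower (edge-< p→x) p∈B) q∈B p→x x→q

  -- Mutual covers force equal member sets: by induction on rank, membership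
  -- agrees below every bound, since a least disagreement cannot exist.
  same-members : ∀ {A B} → 2 ≤ m → length A ≤ 2 → length B ≤ 2 →
                 (∀ {y} → y ∈ A → y ∉ B → Cover B y) →
                 (∀ {y} → y ∈ B → y ∉ A → Cover A y) →
                 ∀ y → (y ∈ A) ⇔ (y ∈ B)
  same-members {A} {B} 2≤m |A|≤2 |B|≤2 coverA coverB y = agree (suc (rank y)) ≤-refl
    where
    module AB = Exchange 2≤m A B |A|≤2 |B|≤2 coverA coverB
    module BA = Exchange 2≤m B A |B|≤2 |A|≤2 coverB coverA

    agree : ∀ n {y} → rank y < n → (y ∈ A) ⇔ (y ∈ B)
    agree (suc n) {y} (s≤s y≤n) = mk⇔ A→B B→A
      where
      below : ∀ {z} → rank z < rank y → (z ∈ A) ⇔ (z ∈ B)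
      below z<y = agree n (<-≤-trans z<y y≤n)

      A→B : y ∈ A → y ∈ B
      A→B y∈A with y ∈? B
      ... | yes y∈B = y∈B
      ... | no y∉B =
        ⊥-elim (AB.no-least-difference y∈A y∉B (λ z<y → Equivalence.from (below z<y)))

      B→A : y ∈ B → y ∈ A
      B→A y∈B with y ∈? A
      ... | yes y∈A = y∈A
      ... | no y∉A =
        ⊥-elim (BA.no-least-difference y∈B y∉A (λ z<y → Equivalence.to (below z<y)))

  -- If every measurement path through A meets B, then B covers each node of A ∖ B:
  -- otherwise a rising path through that node avoids B.
  covered : ∀ {A B} → 2 ≤ m → ∀ r → length B ≤ 2 →
            (∀ ps → PathsThrough E In Out r A ps → PathsThrough E In Out r B ps) →
            ∀ {y} → y ∈ A → y ∉ B → Cover B y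
  covered 2≤m r |B|≤2 A⇒B y∈A y∉B with path-or-cover 2≤m |B|≤2 y∉B
  ... | inj₂ y-covered = y-covered
  ... | inj₁ (ps , rising , y∈ps , avoid) =
    ⊥-elim (avoid (proj₂ (A⇒B ps (rising-measured r rising , _ , y∈A , y∈ps))))

  identifiable-2 : 2 ≤ m → ∀ r → Identifiable E In Out r 2
  identifiable-2 2≤m r U W _ _ |U|≤2 |W|≤2 U≉W same-paths =
    U≉W (same-members 2≤m |U|≤2 |W|≤2
           (covered 2≤m r |W|≤2 (λ ps → Equivalence.to (same-paths ps)))
           (covered 2≤m r |U|≤2 (λ ps → Equivalence.from (same-paths ps))))

-- No j ≥ 3 works (n ≥ 2): the origin is redundant next to its out-neighbours

module UpperBound (k : ℕ) where
  open Grid (suc k)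

  origin east north : V
  origin = (zero , zero)
  east = (suc zero , zero)
  north = (zero , suc zero)

  pair triple : List V
  pair = north ∷ east ∷ []
  triple = origin ∷ pair

  origin-source : ¬ E v origin
  origin-source (inj₁ (() , _))
  origin-source (inj₂ (_ , ()))

  origin-succ : E origin v → v ∈ pair
  origin-succ (inj₁ (e , refl)) = there (here (cong (_, zero) (toℕ-injective e)))
  origin-succ (inj₂ (refl , e)) = here (cong (zero ,_) (toℕ-injective e))

  -- A measurement path through the origin starts there (no in-neighbour) and
  -- continues to one of its out-neighbours.
  through-origin : ∀ r → MeasPath E In Out r ps → origin ∈ ps → Meets pair ps
  through-origin r measured origin∈ with measured-nontrivial r measured
  ... | _ , _ , walk , nontrivial with walk-start-or-pred walk origin∈
  ...   | inj₂ (_ , _ , e) = ⊥-elim (origin-source e)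
  ...   | inj₁ refl with walk
  ...     | stop _ = ⊥-elim (nontrivial _ refl)
  ...     | step e rest = _ , origin-succ e , there (walk-first rest)

  same-paths : ∀ r ps → PathsThrough E In Out r pair ps ⇔ PathsThrough E In Out r triple ps
  same-paths r ps = mk⇔ pair⇒triple triple⇒pair
    where
    pair⇒triple : PathsThrough E In Out r pair ps → PathsThrough E In Out r triple ps
    pair⇒triple (measured , u , u∈pair , u∈ps) = measured , u , there u∈pair , u∈ps
    triple⇒pair : PathsThrough E In Out r triple ps → PathsThrough E In Out r pair ps
    triple⇒pair (measured , u , there u∈pair , u∈ps) = measured , u , u∈pair , u∈ps
    triple⇒pair (measured , _ , here refl , origin∈) = measured , through-origin r measured origin∈

  upper-bound : ∀ r j → Identifiable E In Out r j → j ≤ 2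
  upper-bound r j identifiable with j ≤? 2
  ... | yes j≤2 = j≤2
  ... | no j≰2 = ⊥-elim (identifiable pair triple unique-pair unique-triple
                           (≤-trans (s≤s (s≤s z≤n)) 3≤j) 3≤j pair≉triple (same-paths r))
    where
    3≤j : 3 ≤ j
    3≤j = ≰⇒> j≰2
    unique-pair : Unique pair
    unique-pair = ((λ ()) ∷ []) ∷ [] ∷ []
    unique-triple : Unique triple
    unique-triple = ((λ ()) ∷ (λ ()) ∷ []) ∷ unique-pair
    pair≉triple : ¬ (∀ v → (v ∈ pair) ⇔ (v ∈ triple))
    pair≉triple same with Equivalence.from (same origin) (here refl)
    ... | here ()
    ... | there (here ())

theorem3 : (n : ℕ) → 3 ≤ n → (r : Routing) →
    IsMu (GridE n) (GridIn n) (GridOut n) r 2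
theorem3 (suc (suc (suc k))) (s≤s (s≤s (s≤s z≤n))) r =
  Grid.identifiable-2 (suc (suc k)) (s≤s (s≤s z≤n)) r , UpperBound.upper-bound (suc k) r
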